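{- For $n\ge 1$ let $r_n$ denote the number of words of length $n$ over $\{0,1\}$ that are removable in the no-gaps coin-removal process. Then $r_{n+1}=r_n+2r_{n-1}+1$ for all $n\ge 2$ (with $r_1=1$, $r_2=2$).
   Context: Words over $\{0,1\}$ encode rows of coins, $1$ = heads-up, $0$ = tails-up. A move removes a heads-up coin, flips the coins immediately to its left and right (those that exist), and then pushes the remaining coins together so that coins formerly on either side of the removed coin become adjacent. A word is removable if some sequence of moves removes all coins. -}

module Defs where

open import Data.Bool using (Bool; true; false; not)
open import Data.List using (List; []; _∷_; _++_; length; filter)
open import Data.Nat using (ℕ; zero; suc)
open import Relation.Nullary using (Dec)
open import Relation.Binary.PropositionalEquality using (_≡_)

-- A word over {0,1}: true = 1 = heads-up, false = 0 = tails-up.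
Word : Set
Word = List Bool

flipLast : Word → Word
flipLast []           = []
flipLast (x ∷ [])     = not x ∷ []
flipLast (x ∷ y ∷ xs) = x ∷ flipLast (y ∷ xs)

flipHead : Word → Word
flipHead []       = []
flipHead (x ∷ xs) = not x ∷ xs

data Move : Word → Word → Set where
  move : (xs ys : Word) → Move (xs ++ true ∷ ys) (flipLast xs ++ flipHead ys)

data Removable : Word → Set where
  done : Removable []
  step : ∀ {w w'} → Move w w' → Removable w' → Removable w

words : ℕ → List Word
words zero    = [] ∷ []
words (suc n) = Data.List.map (false ∷_) (words n) ++ Data.List.map (true ∷_) (words n)

r : ((w : Word) → Dec (Removable w)) → ℕ → ℕ
r dec n = length (filter dec (words n))

{-# OPTIONS --safe #-}
-- Read a word left to right as a walk in ℤ/3 starting at −1, where tails acts by x ↦ −x and heads by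
-- x ↦ x + 1, and call the word accepted if the walk does not end at 1. Removing an interior heads coin
-- replaces x 1 b by x̄ b̄, and both act by the same map; at the two ends the start value −1 and the
-- final test "≠ 1" absorb the missing neighbour. So acceptance is invariant under moves, and a word is
-- removable iff it is empty, or contains a heads coin and is accepted: every such nonempty word has a
-- move to a word that is again empty or contains a heads coin.
-- The numbers aₙ of accepted words satisfy aₙ₊₂ = aₙ₊₁ + 2aₙ, and for n ≥ 1 the only accepted word
-- without heads is 0ⁿ for even n, so rₙ = aₙ − [n even]; the alternating correction yields the + 1.
module Submission where

open import Defs
import Algebra.Properties.CommutativeSemigroup as CommSemigroupProperties
open import Data.Bool using (Bool; true; false; not; _∧_; _∨_; T; if_then_else_)
open import Data.Bool.ListAction using (or)
open import Data.Bool.Properties using (T-∧; T-∨)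
open import Data.Empty using (⊥-elim)
open import Data.List using (List; []; _∷_; _++_; [_]; length; filter; map; foldl; null; replicate)
open import Data.List.Properties using (length-++; ++-identityʳ)
open import Data.Nat using (ℕ; zero; suc; _+_; _*_; _∸_; _≥_; _<_; s≤s)
open import Data.Nat.Induction using (<-wellFounded)
open import Data.Nat.Properties
  using (+-comm; +-identityʳ; +-cancelʳ-≡; +-monoʳ-<; n<1+n; +-commutativeSemigroup; module ≤-Reasoning)
open import Data.Nat.Tactic.RingSolver using (solve-∀)
open import Data.Product using (Σ; _×_; _,_; proj₂)
open import Data.Sum using (inj₂)
open import Data.Unit using (tt)
open import Function using (_∘_; _on_; flip; Equivalence; _⇔_; mk⇔)
open import Induction.WellFounded using (Acc; acc)
import Relation.Binary.Construct.On as On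
open import Relation.Binary.PropositionalEquality
  using (_≡_; refl; sym; trans; cong; cong₂; subst; module ≡-Reasoning)
open import Relation.Nullary using (Dec; yes; no)
open import Relation.Unary using (Decidable)

open Equivalence using (to; from)

data ℤ₃ : Set where
  0₃ 1₃ 2₃ : ℤ₃

-_ : ℤ₃ → ℤ₃
- 0₃ = 0₃
- 1₃ = 2₃
- 2₃ = 1₃

suc₃ : ℤ₃ → ℤ₃
suc₃ 0₃ = 1₃
suc₃ 1₃ = 2₃
suc₃ 2₃ = 0₃

act : Bool → ℤ₃ → ℤ₃
act false = -_
act true  = suc₃

run : ℤ₃ → Word → ℤ₃
run = foldl (flip act)

accepting : ℤ₃ → Bool
accepting 1₃ = false
accepting _  = true

accepted : Word → Bool
accepted w = accepting (run 2₃ w)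

act-interior-move : ∀ x b s → act b (suc₃ (act x s)) ≡ act (not b) (act (not x) s)
act-interior-move false false 0₃ = refl
act-interior-move false false 1₃ = refl
act-interior-move false false 2₃ = refl
act-interior-move false true  0₃ = refl
act-interior-move false true  1₃ = refl
act-interior-move false true  2₃ = refl
act-interior-move true  false 0₃ = refl
act-interior-move true  false 1₃ = refl
act-interior-move true  false 2₃ = refl
act-interior-move true  true  0₃ = refl
act-interior-move true  true  1₃ = refl
act-interior-move true  true  2₃ = refl

accepting-right-end-act : ∀ x s → accepting (suc₃ (act x s)) ≡ accepting (act (not x) s)
accepting-right-end-act false 0₃ = refl
accepting-right-end-act false 1₃ = refl
accepting-right-end-act false 2₃ = refl
accepting-right-end-act true  0₃ = refl
accepting-right-end-act true  1₃ = refl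
accepting-right-end-act true  2₃ = refl

run-interior-move : ∀ s x xs b ys →
  run s ((x ∷ xs) ++ true ∷ b ∷ ys) ≡ run s (flipLast (x ∷ xs) ++ not b ∷ ys)
run-interior-move s x []       b ys = cong (flip run ys) (act-interior-move x b s)
run-interior-move s x (y ∷ xs) b ys = run-interior-move (act x s) y xs b ys

accepting-right-end-move : ∀ s x xs →
  accepting (run s ((x ∷ xs) ++ true ∷ [])) ≡ accepting (run s (flipLast (x ∷ xs)))
accepting-right-end-move s x []       = accepting-right-end-act x s
accepting-right-end-move s x (y ∷ xs) = accepting-right-end-move (act x s) y xs

accepted-invariant : ∀ {w w'} → Move w w' → accepted w ≡ accepted w'
accepted-invariant (move []       [])           = refl
accepted-invariant (move []       (false ∷ ys)) = refl
accepted-invariant (move []       (true  ∷ ys)) = refl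
accepted-invariant (move (x ∷ xs) [])           =
  trans (accepting-right-end-move 2₃ x xs)
        (cong (accepting ∘ run 2₃) (sym (++-identityʳ (flipLast (x ∷ xs)))))
accepted-invariant (move (x ∷ xs) (b ∷ ys))     = cong accepting (run-interior-move 2₃ x xs b ys)

removableᵇ : Word → Bool
removableᵇ w = (null w ∨ or w) ∧ accepted w

or-middle-heads : ∀ xs ys → T (or (xs ++ true ∷ ys))
or-middle-heads []       ys = tt
or-middle-heads (x ∷ xs) ys = from T-∨ (inj₂ (or-middle-heads xs ys))

removableᵇ-sound : ∀ {w} → Removable w → T (removableᵇ w)
removableᵇ-sound done = tt
removableᵇ-sound (step m@(move xs ys) removable) =
  from T-∧ ( from T-∨ (inj₂ (or-middle-heads xs ys))
           , subst T (sym (accepted-invariant m)) (proj₂ (to T-∧ (removableᵇ-sound removable))))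

tails : ℕ → Word
tails n = replicate n false

first-heads : ∀ w → T (or w) → Σ ℕ λ a → Σ Word λ ys → w ≡ tails a ++ true ∷ ys
first-heads (true  ∷ w) _ = 0 , w , refl
first-heads (false ∷ w) h with a , ys , refl ← first-heads w h = suc a , ys , refl

or-flipLast-tails : ∀ a zs → T (or (flipLast (tails (suc a)) ++ zs))
or-flipLast-tails zero    zs = tt
or-flipLast-tails (suc a) zs = or-flipLast-tails a zs

progress : ∀ w → T (or w) → T (accepted w) → Σ Word λ w' → Move w w' × T (null w' ∨ or w')
progress w heads accepts with first-heads w heads
... | suc a , ys , refl =
  _ , move (tails (suc a)) ys , from T-∨ (inj₂ (or-flipLast-tails a (flipHead ys)))
... | zero , []                , refl = _ , move [] [] , tt
... | zero , false ∷ ys        , refl = _ , move [] (false ∷ ys) , tt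
-- 11 is the one word here whose moves all destroy every heads coin, and it is not accepted.
... | zero , true ∷ []         , refl = ⊥-elim accepts
... | zero , true ∷ true ∷ ys  , refl = _ , move [] (true ∷ true ∷ ys) , tt
... | zero , true ∷ false ∷ ys , refl = _ , move (true ∷ []) (false ∷ ys) , tt

length-flipLast : ∀ xs → length (flipLast xs) ≡ length xs
length-flipLast []           = refl
length-flipLast (x ∷ [])     = refl
length-flipLast (x ∷ y ∷ xs) = cong suc (length-flipLast (y ∷ xs))

length-flipHead : ∀ ys → length (flipHead ys) ≡ length ys
length-flipHead []       = refl
length-flipHead (y ∷ ys) = refl

move-shortens : ∀ {w w'} → Move w w' → length w' < length w
move-shortens (move xs ys) = begin-strict
  length (flipLast xs ++ flipHead ys)         ≡⟨ length-++ (flipLast xs) ⟩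
  length (flipLast xs) + length (flipHead ys) ≡⟨ cong₂ _+_ (length-flipLast xs) (length-flipHead ys) ⟩
  length xs + length ys                       <⟨ +-monoʳ-< (length xs) (n<1+n (length ys)) ⟩
  length xs + length (true ∷ ys)              ≡⟨ length-++ xs ⟨
  length (xs ++ true ∷ ys)                    ∎
  where open ≤-Reasoning

removableᵇ-complete : ∀ w → T (removableᵇ w) → Removable w
removableᵇ-complete w = complete (On.wellFounded length <-wellFounded w)
  where
  complete : ∀ {w} → Acc (_<_ on length) w → T (removableᵇ w) → Removable w
  complete {[]}    _         _ = done
  complete {x ∷ w} (acc rec) r
    with heads , accepts ← to T-∧ r
    with w' , m , shape ← progress (x ∷ w) heads accepts
    = step m (complete (rec (move-shortens m))
                       (from T-∧ (shape , subst T (accepted-invariant m) accepts)))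

count : {A : Set} → (A → Bool) → List A → ℕ
count p []       = 0
count p (x ∷ xs) = if p x then suc (count p xs) else count p xs

count-++ : {A : Set} (p : A → Bool) (xs ys : List A) →
           count p (xs ++ ys) ≡ count p xs + count p ys
count-++ p []       ys = refl
count-++ p (x ∷ xs) ys with p x
... | true  = cong suc (count-++ p xs ys)
... | false = count-++ p xs ys

count-map : {A B : Set} (p : B → Bool) (f : A → B) (xs : List A) →
            count p (map f xs) ≡ count (p ∘ f) xs
count-map p f []       = refl
count-map p f (x ∷ xs) with p (f x)
... | true  = cong suc (count-map p f xs)
... | false = count-map p f xs

length-filter≡count : {A : Set} {P : A → Set} (P? : Decidable P) (p : A → Bool) →
                      (∀ x → P x ⇔ T (p x)) → ∀ xs → length (filter P? xs) ≡ count p xs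
length-filter≡count P? p P⇔p []       = refl
length-filter≡count P? p P⇔p (x ∷ xs) with P? x | p x | P⇔p x
... | yes _  | true  | _     = cong suc (length-filter≡count P? p P⇔p xs)
... | yes Px | false | Px⇔⊥ = ⊥-elim (to Px⇔⊥ Px)
... | no ¬Px | true  | Px⇔⊤ = ⊥-elim (¬Px (from Px⇔⊤ tt))
... | no _   | false | _     = length-filter≡count P? p P⇔p xs

count-words-suc : ∀ p n →
  count p (words (suc n)) ≡ count (p ∘ (false ∷_)) (words n) + count (p ∘ (true ∷_)) (words n)
count-words-suc p n = trans (count-++ p (map (false ∷_) (words n)) (map (true ∷_) (words n)))
                            (cong₂ _+_ (count-map p (false ∷_) (words n)) (count-map p (true ∷_) (words n)))

count-words-heads : ∀ p n →
  count p (words n) ≡ count (λ w → or w ∧ p w) (words n) + count p [ tails n ]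
count-words-heads p zero    = refl
count-words-heads p (suc n) = begin
  count p (words (suc n))                   ≡⟨ count-words-suc p n ⟩
  count p₀ (words n) + count p₁ (words n)   ≡⟨ cong (_+ count p₁ (words n)) (count-words-heads p₀ n) ⟩
  heads₀ + allTails + count p₁ (words n)    ≡⟨ xy∙z≈xz∙y heads₀ allTails (count p₁ (words n)) ⟩
  heads₀ + count p₁ (words n) + allTails    ≡⟨ cong (_+ allTails) (count-words-suc (λ w → or w ∧ p w) n) ⟨
  count (λ w → or w ∧ p w) (words (suc n)) + allTails ∎
  where
  open ≡-Reasoning
  open CommSemigroupProperties +-commutativeSemigroup using (xy∙z≈xz∙y)
  p₀ p₁ : Word → Bool
  p₀ = p ∘ (false ∷_)
  p₁ = p ∘ (true ∷_)
  heads₀ allTails : ℕ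
  heads₀   = count (λ w → or w ∧ p₀ w) (words n)
  allTails = count p [ tails (suc n) ]

acceptedCount : ℕ → ℤ₃ → ℕ
acceptedCount n s = count (accepting ∘ run s) (words n)

acceptedCount-suc : ∀ n s →
  acceptedCount (suc n) s ≡ acceptedCount n (- s) + acceptedCount n (suc₃ s)
acceptedCount-suc n s = count-words-suc (accepting ∘ run s) n

acceptedCount-0₃≡2₃ : ∀ n → acceptedCount n 0₃ ≡ acceptedCount n 2₃
acceptedCount-0₃≡2₃ zero    = refl
acceptedCount-0₃≡2₃ (suc n) = begin
  acceptedCount (suc n) 0₃                ≡⟨ acceptedCount-suc n 0₃ ⟩
  acceptedCount n 0₃ + acceptedCount n 1₃ ≡⟨ +-comm (acceptedCount n 0₃) (acceptedCount n 1₃) ⟩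
  acceptedCount n 1₃ + acceptedCount n 0₃ ≡⟨ acceptedCount-suc n 2₃ ⟨
  acceptedCount (suc n) 2₃                ∎
  where open ≡-Reasoning

acceptedCount-recurrence : ∀ n →
  acceptedCount (2 + n) 2₃ ≡ acceptedCount (1 + n) 2₃ + 2 * acceptedCount n 2₃
acceptedCount-recurrence n = begin
  acceptedCount (2 + n) 2₃                              ≡⟨ acceptedCount-suc (1 + n) 2₃ ⟩
  acceptedCount (1 + n) 1₃ + acceptedCount (1 + n) 0₃   ≡⟨ +-comm (acceptedCount (1 + n) 1₃) _ ⟩
  acceptedCount (1 + n) 0₃ + acceptedCount (1 + n) 1₃
    ≡⟨ cong₂ _+_ (acceptedCount-0₃≡2₃ (1 + n)) (acceptedCount-suc n 1₃) ⟩
  acceptedCount (1 + n) 2₃ + (A + A)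
    ≡⟨ cong (λ m → acceptedCount (1 + n) 2₃ + (A + m)) (+-identityʳ A) ⟨
  acceptedCount (1 + n) 2₃ + 2 * A                      ∎
  where
  open ≡-Reasoning
  A : ℕ
  A = acceptedCount n 2₃

removableCount : ℕ → ℕ
removableCount n = count removableᵇ (words n)

r≡removableCount : ∀ dec n → r dec n ≡ removableCount n
r≡removableCount dec n =
  length-filter≡count dec removableᵇ (λ w → mk⇔ removableᵇ-sound (removableᵇ-complete w)) (words n)

removableCount-suc : ∀ n →
  removableCount (suc n) + count accepted [ tails (suc n) ] ≡ acceptedCount (suc n) 2₃
removableCount-suc n = begin
  removableCount (suc n) + count accepted [ tails (suc n) ]
    ≡⟨ cong (_+ count accepted [ tails (suc n) ]) nonempty ⟩
  count (λ w → or w ∧ accepted w) (words (suc n)) + count accepted [ tails (suc n) ]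
    ≡⟨ count-words-heads accepted (suc n) ⟨
  acceptedCount (suc n) 2₃ ∎
  where
  open ≡-Reasoning
  -- On a nonempty word removableᵇ unfolds to or w ∧ accepted w, so splitting off the first coin suffices.
  nonempty : removableCount (suc n) ≡ count (λ w → or w ∧ accepted w) (words (suc n))
  nonempty = trans (count-words-suc removableᵇ n) (sym (count-words-suc (λ w → or w ∧ accepted w) n))

-- Since − − 2₃ computes to 2₃, tails (2 + n) and tails n are accepted alike by definition.
tails-accepted-alternates : ∀ n → count accepted [ tails n ] + count accepted [ tails (suc n) ] ≡ 1
tails-accepted-alternates zero    = refl
tails-accepted-alternates (suc n) =
  trans (+-comm (count accepted [ tails (suc n) ]) (count accepted [ tails n ]))
        (tails-accepted-alternates n)

cancel-alternating : ∀ a b c p q → a + p ≡ (b + q) + 2 * (c + p) → p + q ≡ 1 → a ≡ b + 2 * c + 1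
cancel-alternating a b c p q eq p+q≡1 = +-cancelʳ-≡ p a (b + 2 * c + 1) (begin
  a + p                         ≡⟨ eq ⟩
  (b + q) + 2 * (c + p)         ≡⟨ regroup b c p q ⟩
  (b + 2 * c + (p + q)) + p     ≡⟨ cong (λ m → b + 2 * c + m + p) p+q≡1 ⟩
  (b + 2 * c + 1) + p           ∎)
  where
  open ≡-Reasoning
  regroup : ∀ b c p q → (b + q) + 2 * (c + p) ≡ (b + 2 * c + (p + q)) + p
  regroup = solve-∀

removableCount-recurrence : ∀ k →
  removableCount (3 + k) ≡ removableCount (2 + k) + 2 * removableCount (1 + k) + 1
removableCount-recurrence k =
  cancel-alternating
    (removableCount (3 + k)) (removableCount (2 + k)) (removableCount (1 + k))
    (count accepted [ tails (1 + k) ]) (count accepted [ tails (2 + k) ])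
    (begin
      removableCount (3 + k) + count accepted [ tails (3 + k) ]  ≡⟨ removableCount-suc (2 + k) ⟩
      acceptedCount (3 + k) 2₃                                   ≡⟨ acceptedCount-recurrence (1 + k) ⟩
      acceptedCount (2 + k) 2₃ + 2 * acceptedCount (1 + k) 2₃
        ≡⟨ cong₂ (λ u v → u + 2 * v) (removableCount-suc (1 + k)) (removableCount-suc k) ⟨
      removableCount (2 + k) + count accepted [ tails (2 + k) ]
        + 2 * (removableCount (1 + k) + count accepted [ tails (1 + k) ]) ∎)
    (tails-accepted-alternates (1 + k))
  where open ≡-Reasoning

proposition3 : (dec : (w : Word) → Dec (Removable w)) →
    (r dec 1 ≡ 1) × (r dec 2 ≡ 2) ×
    ((n : ℕ) → n ≥ 2 → r dec (n + 1) ≡ r dec n + 2 * r dec (n ∸ 1) + 1)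
proposition3 dec = r≡removableCount dec 1 , r≡removableCount dec 2 , recurrence
  where
  recurrence : (n : ℕ) → n ≥ 2 → r dec (n + 1) ≡ r dec n + 2 * r dec (n ∸ 1) + 1
  recurrence (suc (suc k)) (s≤s (s≤s _))
    rewrite +-comm k 1 | r≡removableCount dec (3 + k)
          | r≡removableCount dec (2 + k) | r≡removableCount dec (1 + k)
    = removableCount-recurrence k
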